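{- Let $(X,+)$ be an abelian group and $\mathcal{A}$ a finite Sidon set in $X$. Then $0\le |T(z)|\le|\mathcal{A}|$ for all $z\in X\setminus\mathcal{A}$.
   Context: A nonempty subset $\mathcal{A}$ of an abelian group $X$ is a Sidon set if $a+b=c+d$ with $a,b,c,d\in\mathcal{A}$ implies $\{a,b\}=\{c,d\}$. For $z\in X\setminus\mathcal{A}$, $T(z):=\{(a_1,a_2,a_3)\in\mathcal{A}^3: z=a_1-a_2+a_3\}$. -}

module Defs where

open import Level using (Level; _⊔_)
open import Algebra.Bundles using (AbelianGroup)
open import Data.Nat using (ℕ; _≤_)
open import Data.Fin using (Fin)
open import Data.Product using (Σ; _×_; _,_; proj₁)
open import Data.Sum using (_⊎_)
open import Relation.Nullary using (¬_)
open import Relation.Binary.PropositionalEquality using (_≡_)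

module _ {c ℓ : Level} (G : AbelianGroup c ℓ) where
  open AbelianGroup G

  record FinSubset (n : ℕ) : Set (c ⊔ ℓ) where
    field
      elem  : Fin n → Carrier
      elem-injective : ∀ i j → elem i ≈ elem j → i ≡ j
  open FinSubset public

  _∈A_ : ∀ {n} → Carrier → FinSubset n → Set ℓ
  x ∈A A = Σ (Fin _) λ i → x ≈ elem A i

  IsSidon : ∀ {n} → FinSubset n → Set (c ⊔ ℓ)
  IsSidon {n} A = (1 ≤ n) ×
    (∀ (a b c' d : Carrier) → a ∈A A → b ∈A A → c' ∈A A → d ∈A A →
       a ∙ b ≈ c' ∙ d → (a ≈ c' × b ≈ d) ⊎ (a ≈ d × b ≈ c'))

  -- T(z) = {(a₁,a₂,a₃) ∈ A³ : z = a₁ - a₂ + a₃}; elements of A are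
  -- identified with their (unique) indices in the enumeration.
  T : ∀ {n} → FinSubset n → Carrier → Set ℓ
  T {n} A z = Σ (Fin n × Fin n × Fin n) λ where
    (i , j , k) → z ≈ (elem A i ∙ (elem A j) ⁻¹) ∙ elem A k

  -- |S| ≤ m for a (possibly non-decidable) type S: every injection
  -- Fin k → S has k ≤ m.
  AtMost : ∀ {s t} (S : Set s) (_~_ : S → S → Set t) → ℕ → Set (s ⊔ t)
  AtMost S _~_ m = ∀ k (f : Fin k → S) → (∀ x y → f x ~ f y → x ≡ y) → k ≤ m

  |T|≤ : ∀ {n} → FinSubset n → Carrier → ℕ → Set ℓ
  |T|≤ A z m = AtMost (T A z) (λ u v → proj₁ u ≡ proj₁ v) m

module Submission where

-- Let A be a Sidon set, z ∉ A, and let (a, b, c) ∈ T(z),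
-- i.e. z = a - b + c.  Rewriting this as z + b = a + c shows that two
-- triples (a, b, c), (a, b', c') of T(z) sharing their first entry satisfy
-- c + b' = c' + b.  The Sidon property then gives either c = c', b' = b
-- (the triples coincide) or c = b, which forces z = a ∈ A, impossible.
-- Hence a triple of T(z) is determined by its first entry, so projecting
-- to the first entry is an injection T(z) → A, and |T(z)| ≤ |A|.

open import Defs
open import Level using (Level)
open import Algebra.Bundles using (AbelianGroup)
open import Data.Nat using (ℕ)
open import Data.Fin using (Fin)
open import Data.Fin.Properties using (injective⇒≤)
open import Data.Product using (_,_; proj₁)
open import Data.Sum using (inj₁; inj₂)
open import Data.Empty using (⊥-elim)
open import Relation.Nullary using (¬_)
open import Relation.Binary.PropositionalEquality using (_≡_; refl)
import Algebra.Properties.AbelianGroup as AbelianGroupProperties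
import Algebra.Properties.CommutativeSemigroup as CommutativeSemigroupProperties
import Relation.Binary.Reasoning.Setoid as SetoidReasoning

module _ {c ℓ : Level} (G : AbelianGroup c ℓ) where
  open AbelianGroup G renaming (refl to ≈-refl)
  open AbelianGroupProperties G using (∙-cancelˡ; ∙-cancelʳ; //-rightDividesˡ)
  open CommutativeSemigroupProperties commutativeSemigroup using (xy∙z≈xz∙y)
  open SetoidReasoning setoid

  move-subtrahend : ∀ z a b d → z ≈ (a - b) ∙ d → z ∙ b ≈ a ∙ d
  move-subtrahend z a b d z≈a-b+d = begin
    z ∙ b                ≈⟨ ∙-congʳ z≈a-b+d ⟩
    ((a - b) ∙ d) ∙ b   ≈⟨ xy∙z≈xz∙y (a - b) d b ⟩
    ((a - b) ∙ b) ∙ d   ≈⟨ ∙-congʳ (//-rightDividesˡ b a) ⟩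
    a ∙ d                ∎

  eliminate-common : ∀ z a b d b' d' → z ∙ b ≈ a ∙ d → z ∙ b' ≈ a ∙ d' →
                     d ∙ b' ≈ d' ∙ b
  eliminate-common z a b d b' d' zb≈ad zb'≈ad' = ∙-cancelˡ a _ _ (begin
    a ∙ (d ∙ b')    ≈⟨ assoc a d b' ⟨
    (a ∙ d) ∙ b'    ≈⟨ ∙-congʳ zb≈ad ⟨
    (z ∙ b) ∙ b'    ≈⟨ xy∙z≈xz∙y z b b' ⟩
    (z ∙ b') ∙ b    ≈⟨ ∙-congʳ zb'≈ad' ⟩
    (a ∙ d') ∙ b    ≈⟨ assoc a d' b ⟩
    a ∙ (d' ∙ b)    ∎)

  -- If the relation  z + b = a + d  has d = b, it degenerates to z = a;
  -- this is the Sidon alternative that would put z in A.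
  degenerate-relation : ∀ z a b d → z ∙ b ≈ a ∙ d → d ≈ b → z ≈ a
  degenerate-relation z a b d zb≈ad d≈b = ∙-cancelʳ b z a (begin
    z ∙ b   ≈⟨ zb≈ad ⟩
    a ∙ d   ≈⟨ ∙-congˡ d≈b ⟩
    a ∙ b   ∎)

  T-determined-by-first : ∀ {n} (A : FinSubset G n) → IsSidon G A →
    ∀ z → ¬ (_∈A_ G z A) → (u v : T G A z) →
    proj₁ (proj₁ u) ≡ proj₁ (proj₁ v) → proj₁ u ≡ proj₁ v
  T-determined-by-first A (_ , sidon) z z∉A ((i , j , k) , z≈ijk) ((.i , j' , k') , z≈ij'k') refl
    with sidon (e k) (e j') (e k') (e j) (k , ≈-refl) (j' , ≈-refl) (k' , ≈-refl) (j , ≈-refl)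
               (eliminate-common z (e i) (e j) (e k) (e j') (e k') zj≈ik zj'≈ik')
    where
      e : Fin _ → Carrier
      e = elem A
      zj≈ik : z ∙ e j ≈ e i ∙ e k
      zj≈ik = move-subtrahend z (e i) (e j) (e k) z≈ijk
      zj'≈ik' : z ∙ e j' ≈ e i ∙ e k'
      zj'≈ik' = move-subtrahend z (e i) (e j') (e k') z≈ij'k'
  ... | inj₁ (k≈k' , j'≈j)
    with elem-injective A k k' k≈k' | elem-injective A j' j j'≈j
  ... | refl | refl = refl
  T-determined-by-first A _ z z∉A ((i , j , k) , z≈ijk) _ refl
    | inj₂ (k≈j , _) =
    ⊥-elim (z∉A (i , degenerate-relation z (elem A i) (elem A j) (elem A k)
                       (move-subtrahend z (elem A i) (elem A j) (elem A k) z≈ijk) k≈j))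

mainTheorem4 : ∀ {c ℓ : Level} (G : AbelianGroup c ℓ) (n : ℕ) (A : FinSubset G n) →
    IsSidon G A →
    ∀ (z : AbelianGroup.Carrier G) → ¬ (_∈A_ G z A) →
    |T|≤ G A z n
mainTheorem4 G n A sidon z z∉A k f f-injective =
  injective⇒≤ {f = first-index}
    (λ {x} {y} same-first →
       f-injective x y (T-determined-by-first G A sidon z z∉A (f x) (f y) same-first))
  where
    first-index : Fin k → Fin n
    first-index x = proj₁ (proj₁ (f x))
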